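{- A quasi-Riordan array $[g,f]$ is a Riordan array (i.e. equals, as a matrix, $(g',f')$ for some $g'\in\mathcal{F}_0$ and $f'\in\mathcal{F}_1$) if and only if $f=tg$, in which case $[g,f]=(g,t)$. Consequently $\mathcal{A}_r:=\{[g,tg]: g\in\mathcal{F}_0,\ g(0)=1\}$ is a subgroup of the quasi-Riordan group $\mathcal{R}_r$.
   Context: $\mathbb{K}$ is $\mathbb{R}$ or $\mathbb{C}$; $\mathcal{F}_r$ denotes the set of formal power series in $\mathbb{K}[[t]]$ of order $r$. The Riordan array $(g,f)$, $g\in\mathcal{F}_0$, $f\in\mathcal{F}_1$, is the infinite lower triangular matrix whose $k$th column has generating function $gf^k$. For $g\in\mathcal{F}_0$ with $g(0)=1$ and $f\in\mathcal{F}_1$, the quasi-Riordan array $[g,f]$ is the infinite lower triangular matrix whose $0$th column has generating function $g$ and whose $j$th column, for $j\ge1$, has generating function $t^{j-1}f$. $\mathcal{R}_r$ is the set of all quasi-Riordan arrays, a group under matrix multiplication. -}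

module Defs where

open import Level using (_⊔_)
open import Data.Nat using (ℕ; zero; suc; _∸_)
open import Data.Product using (Σ; ∃; _×_; _,_)
open import Relation.Nullary using (¬_)
open import Data.Sum using (_⊎_)
open import Algebra.Bundles using (CommutativeRing)

IsField : ∀ {c ℓ} → CommutativeRing c ℓ → Set (c ⊔ ℓ)
IsField R = ¬ (1# ≈ 0#) × (∀ x → ¬ (x ≈ 0#) → ∃ λ y → x * y ≈ 1#)
  where open CommutativeRing R

module FPS {c ℓ} (R : CommutativeRing c ℓ) where
  open CommutativeRing R public using (_≈_; _+_; _*_; 0#; 1#) renaming (Carrier to K)

  Series : Set c
  Series = ℕ → K

  -- infinite matrices, indexed (row, column)
  Matrix : Set c
  Matrix = ℕ → ℕ → K

  sumTo : (ℕ → K) → ℕ → K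
  sumTo h zero    = h zero
  sumTo h (suc n) = sumTo h n + h (suc n)

  _·_ : Series → Series → Series
  (a · b) n = sumTo (λ i → a i * b (n ∸ i)) n

  tS : Series
  tS (suc zero) = 1#
  tS _          = 0#

  oneS : Series
  oneS zero    = 1#
  oneS (suc _) = 0#

  _^S_ : Series → ℕ → Series
  f ^S zero    = oneS
  f ^S suc k   = (f ^S k) · f

  _≈S_ : Series → Series → Set ℓ
  a ≈S b = ∀ n → a n ≈ b n

  _≈M_ : Matrix → Matrix → Set ℓ
  A ≈M B = ∀ n k → A n k ≈ B n k

  Order0 : Series → Set ℓ
  Order0 g = ¬ (g 0 ≈ 0#)

  Order1 : Series → Set ℓ
  Order1 f = (f 0 ≈ 0#) × ¬ (f 1 ≈ 0#)

  Riordan : Series → Series → Matrix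
  Riordan g f n k = (g · (f ^S k)) n

  QRiordan : Series → Series → Matrix
  QRiordan g f n zero    = g n
  QRiordan g f n (suc j) = ((tS ^S j) · f) n

  -- product of (lower triangular) infinite matrices
  _⊗_ : Matrix → Matrix → Matrix
  (A ⊗ B) n k = sumTo (λ j → A n j * B j k) n

  Id : Matrix
  Id zero    zero    = 1#
  Id zero    (suc _) = 0#
  Id (suc _) zero    = 0#
  Id (suc n) (suc k) = Id n k

  InRr : Matrix → Set (c ⊔ ℓ)
  InRr M = Σ Series λ g → Σ Series λ f →
             (g 0 ≈ 1#) × Order1 f × (M ≈M QRiordan g f)

  InAr : Matrix → Set (c ⊔ ℓ)
  InAr M = Σ Series λ g → (g 0 ≈ 1#) × (M ≈M QRiordan g (tS · g))

{-# OPTIONS --safe #-}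
module Submission where

-- Matching the first three columns of [g, f] with those of a Riordan array (g′, f′) forces
-- g′ = g, f = g f′ and t f = g f′². Cancelling g gives f′² = t f′; writing f′ = t u this is
-- t² u² = t² u, so u² = u, and since u(0) = f′(1) is invertible, u = 1. Thus f′ = t and
-- f = t g. The arrays [g, t g] = (g, t) are the Toeplitz matrices of the series g with
-- g(0) = 1, and (g, t)(h, t) = (h g, t), so they form a group: the inverse of (g, t) is
-- (g⁻¹, t), where g⁻¹ is built coefficientwise by course-of-values recursion.

open import Defs
open import Data.Nat using (ℕ; zero; suc; _∸_; _≤_; _<_; z≤n; s≤s)
open import Data.Nat.Properties using (m≤n⇒m≤1+n; ≤-refl; m∸n≤m; m∸[m∸n]≡n)
open import Data.Nat.Induction using (<-wellFounded; <-rec)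
open import Data.Product using (Σ; _×_; _,_)
open import Relation.Nullary using (¬_)
open import Relation.Binary.PropositionalEquality as ≡ using (_≡_)
open import Induction.WellFounded using (WfRec; module FixPoint)
open import Algebra.Bundles using (CommutativeRing)
open import Function.Bundles using (_⇔_; mk⇔)

module SeriesProperties {c ℓ} (R : CommutativeRing c ℓ) where
  open CommutativeRing R
  open FPS R hiding (_≈_; _+_; _*_; 0#; 1#)
  open import Algebra.Properties.Ring ring using (+-cancelʳ)
  open import Relation.Binary.Reasoning.Setoid setoid

  *-cancelˡ-unit : ∀ {w u a b} → w * u ≈ 1# → u * a ≈ u * b → a ≈ b
  *-cancelˡ-unit {w} {u} {a} {b} wu≈1 ua≈ub = begin
    a             ≈⟨ *-identityˡ a ⟨
    1# * a        ≈⟨ *-congʳ wu≈1 ⟨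
    (w * u) * a   ≈⟨ *-assoc w u a ⟩
    w * (u * a)   ≈⟨ *-congˡ ua≈ub ⟩
    w * (u * b)   ≈⟨ *-assoc w u b ⟨
    (w * u) * b   ≈⟨ *-congʳ wu≈1 ⟩
    1# * b        ≈⟨ *-identityˡ b ⟩
    b             ∎

  sumTo-cong : ∀ {h h′ : ℕ → K} n → (∀ i → i ≤ n → h i ≈ h′ i) → sumTo h n ≈ sumTo h′ n
  sumTo-cong zero    h≈h′ = h≈h′ 0 z≤n
  sumTo-cong (suc n) h≈h′ =
    +-cong (sumTo-cong n (λ i i≤n → h≈h′ i (m≤n⇒m≤1+n i≤n))) (h≈h′ (suc n) ≤-refl)

  sumTo-cong-≡ : ∀ {h h′ : ℕ → K} n → (∀ i → h i ≡ h′ i) → sumTo h n ≡ sumTo h′ n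
  sumTo-cong-≡ zero    h≡h′ = h≡h′ 0
  sumTo-cong-≡ (suc n) h≡h′ = ≡.cong₂ _+_ (sumTo-cong-≡ n h≡h′) (h≡h′ (suc n))

  sumTo-unconsˡ : ∀ (h : ℕ → K) n → sumTo h (suc n) ≈ h 0 + sumTo (λ i → h (suc i)) n
  sumTo-unconsˡ h zero    = refl
  sumTo-unconsˡ h (suc n) = trans (+-congʳ (sumTo-unconsˡ h n)) (+-assoc _ _ _)

  sumTo-≈0 : ∀ {h : ℕ → K} n → (∀ i → i ≤ n → h i ≈ 0#) → sumTo h n ≈ 0#
  sumTo-≈0 n h≈0 = trans (sumTo-cong n h≈0) (sumTo-zeros n)
    where
    sumTo-zeros : ∀ n → sumTo (λ _ → 0#) n ≈ 0#
    sumTo-zeros zero    = refl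
    sumTo-zeros (suc n) = trans (+-congʳ (sumTo-zeros n)) (+-identityʳ 0#)

  sumTo-reverse : ∀ (h : ℕ → K) n → sumTo h n ≈ sumTo (λ i → h (n ∸ i)) n
  sumTo-reverse h zero    = refl
  sumTo-reverse h (suc n) = begin
    sumTo h n + h (suc n)                   ≈⟨ +-congʳ (sumTo-reverse h n) ⟩
    sumTo (λ i → h (n ∸ i)) n + h (suc n)   ≈⟨ +-comm _ _ ⟩
    h (suc n) + sumTo (λ i → h (n ∸ i)) n   ≈⟨ sumTo-unconsˡ (λ i → h (suc n ∸ i)) n ⟨
    sumTo (λ i → h (suc n ∸ i)) (suc n)     ∎

  ·-cong : ∀ {a a′ b b′} → a ≈S a′ → b ≈S b′ → (a · b) ≈S (a′ · b′)
  ·-cong a≈a′ b≈b′ n = sumTo-cong n (λ i _ → *-cong (a≈a′ i) (b≈b′ (n ∸ i)))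

  ·-congˡ : ∀ a {b b′} → b ≈S b′ → (a · b) ≈S (a · b′)
  ·-congˡ a = ·-cong {a} {a} (λ _ → refl)

  ·-congʳ : ∀ b {a a′} → a ≈S a′ → (a · b) ≈S (a′ · b)
  ·-congʳ b a≈a′ = ·-cong {b = b} {b} a≈a′ (λ _ → refl)

  ·-comm : ∀ a b → (a · b) ≈S (b · a)
  ·-comm a b n = begin
    sumTo (λ i → a i * b (n ∸ i)) n                 ≈⟨ sumTo-reverse _ n ⟩
    sumTo (λ i → a (n ∸ i) * b (n ∸ (n ∸ i))) n
      ≈⟨ sumTo-cong n (λ i i≤n → trans (*-congˡ (reflexive (≡.cong b (m∸[m∸n]≡n i≤n)))) (*-comm _ _)) ⟩
    sumTo (λ i → b i * a (n ∸ i)) n                 ∎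

  ·-identityˡ : ∀ a → (oneS · a) ≈S a
  ·-identityˡ a zero    = *-identityˡ _
  ·-identityˡ a (suc n) = begin
    (oneS · a) (suc n)                                  ≈⟨ sumTo-unconsˡ _ n ⟩
    1# * a (suc n) + sumTo (λ i → 0# * a (n ∸ i)) n     ≈⟨ +-cong (*-identityˡ _) (sumTo-≈0 n (λ i _ → zeroˡ _)) ⟩
    a (suc n) + 0#                                      ≈⟨ +-identityʳ _ ⟩
    a (suc n)                                           ∎

  ·-identityʳ : ∀ a → (a · oneS) ≈S a
  ·-identityʳ a n = trans (·-comm a oneS n) (·-identityˡ a n)

  shift : Series → Series
  shift a zero    = 0#
  shift a (suc n) = a n

  shift-cong : ∀ {a b} → a ≈S b → shift a ≈S shift b
  shift-cong a≈b zero    = refl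
  shift-cong a≈b (suc n) = a≈b n

  shift-injective : ∀ {a b} → shift a ≈S shift b → a ≈S b
  shift-injective sa≈sb n = sa≈sb (suc n)

  ·-shiftˡ : ∀ a b → (shift a · b) ≈S shift (a · b)
  ·-shiftˡ a b zero    = zeroˡ _
  ·-shiftˡ a b (suc n) = trans (sumTo-unconsˡ _ n) (trans (+-congʳ (zeroˡ _)) (+-identityˡ _))

  ·-shiftʳ : ∀ a b → (a · shift b) ≈S shift (a · b)
  ·-shiftʳ a b n = trans (·-comm a (shift b) n) (trans (·-shiftˡ b a n) (shift-cong (·-comm b a) n))

  tS≈shift-oneS : tS ≈S shift oneS
  tS≈shift-oneS zero          = refl
  tS≈shift-oneS (suc zero)    = refl
  tS≈shift-oneS (suc (suc n)) = refl

  tS-·≈shift : ∀ a → (tS · a) ≈S shift a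
  tS-·≈shift a n = begin
    (tS · a) n          ≈⟨ ·-congʳ a tS≈shift-oneS n ⟩
    (shift oneS · a) n  ≈⟨ ·-shiftˡ oneS a n ⟩
    shift (oneS · a) n  ≈⟨ shift-cong (·-identityˡ a) n ⟩
    shift a n           ∎

  ·-tS≈shift : ∀ a → (a · tS) ≈S shift a
  ·-tS≈shift a n = trans (·-comm a tS n) (tS-·≈shift a n)

  shift^ : ℕ → Series → Series
  shift^ zero    a = a
  shift^ (suc j) a = shift (shift^ j a)

  shift^-cong : ∀ j {a b} → a ≈S b → shift^ j a ≈S shift^ j b
  shift^-cong zero    a≈b = a≈b
  shift^-cong (suc j) a≈b = shift-cong (shift^-cong j a≈b)

  shift^-shift : ∀ j a → shift^ j (shift a) ≈S shift^ (suc j) a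
  shift^-shift zero    a n = refl
  shift^-shift (suc j) a   = shift-cong (shift^-shift j a)

  shift^-apply : ∀ j a n → j ≤ n → shift^ j a n ≈ a (n ∸ j)
  shift^-apply zero    a n       _         = refl
  shift^-apply (suc j) a (suc n) (s≤s j≤n) = shift^-apply j a n j≤n

  tS^-·≈shift^ : ∀ j a → ((tS ^S j) · a) ≈S shift^ j a
  tS^-·≈shift^ zero    a   = ·-identityˡ a
  tS^-·≈shift^ (suc j) a n = begin
    (((tS ^S j) · tS) · a) n   ≈⟨ ·-congʳ a (·-tS≈shift (tS ^S j)) n ⟩
    (shift (tS ^S j) · a) n    ≈⟨ ·-shiftˡ (tS ^S j) a n ⟩
    shift ((tS ^S j) · a) n    ≈⟨ shift-cong (tS^-·≈shift^ j a) n ⟩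
    shift^ (suc j) a n         ∎

  ·-cancelˡ : ∀ {w g x y} → w * g 0 ≈ 1# → (g · x) ≈S (g · y) → x ≈S y
  ·-cancelˡ {w} {g} {x} {y} wg₀≈1 gx≈gy = <-rec (λ n → x n ≈ y n) step
    where
    step : ∀ n → (∀ {m} → m < n → x m ≈ y m) → x n ≈ y n
    step zero    _  = *-cancelˡ-unit wg₀≈1 (gx≈gy 0)
    step (suc n) ih = *-cancelˡ-unit wg₀≈1 (+-cancelʳ _ _ _ (begin
      g 0 * x (suc n) + sumTo (λ i → g (suc i) * x (n ∸ i)) n   ≈⟨ sumTo-unconsˡ _ n ⟨
      (g · x) (suc n)                                           ≈⟨ gx≈gy (suc n) ⟩
      (g · y) (suc n)                                           ≈⟨ sumTo-unconsˡ _ n ⟩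
      g 0 * y (suc n) + sumTo (λ i → g (suc i) * y (n ∸ i)) n
        ≈⟨ +-congˡ (sumTo-cong n (λ i _ → *-congˡ (sym (ih (s≤s (m∸n≤m n i)))))) ⟩
      g 0 * y (suc n) + sumTo (λ i → g (suc i) * x (n ∸ i)) n   ∎))

  -- g⁻¹(n+1) = - Σ_{i ≤ n} g(i+1) g⁻¹(n-i), the recursion solving (g g⁻¹)(n+1) = 0 when g(0) = 1.
  inverse-step : Series → ∀ n → WfRec _<_ (λ _ → K) n → K
  inverse-step g zero    _   = 1#
  inverse-step g (suc n) rec = - sumTo (λ i → g (suc i) * rec (s≤s (m∸n≤m n i))) n

  inverse : Series → Series
  inverse g = <-rec (λ _ → K) (inverse-step g)

  inverse-suc : ∀ g n → inverse g (suc n) ≡ - sumTo (λ i → g (suc i) * inverse g (n ∸ i)) n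
  inverse-suc g n = FixPoint.unfold-wfRec <-wellFounded (λ _ → K) (inverse-step g) step-ext {suc n}
    where
    step-ext : ∀ n {rec rec′ : WfRec _<_ (λ _ → K) n} →
               (∀ {m} (m<n : m < n) → rec m<n ≡ rec′ m<n) → inverse-step g n rec ≡ inverse-step g n rec′
    step-ext zero    _       = ≡.refl
    step-ext (suc n) rec≡rec′ = ≡.cong -_ (sumTo-cong-≡ n (λ i → ≡.cong (g (suc i) *_) (rec≡rec′ _)))

  ·-inverseʳ : ∀ g → g 0 ≈ 1# → (g · inverse g) ≈S oneS
  ·-inverseʳ g g₀≈1 zero    = trans (*-congʳ g₀≈1) (*-identityˡ _)
  ·-inverseʳ g g₀≈1 (suc n) = begin
    (g · inverse g) (suc n)         ≈⟨ sumTo-unconsˡ _ n ⟩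
    g 0 * inverse g (suc n) + S     ≈⟨ +-congʳ (*-cong g₀≈1 (reflexive (inverse-suc g n))) ⟩
    1# * - S + S                    ≈⟨ +-congʳ (*-identityˡ _) ⟩
    - S + S                         ≈⟨ -‿inverseˡ S ⟩
    0#                              ∎
    where
    S : K
    S = sumTo (λ i → g (suc i) * inverse g (n ∸ i)) n

  Toeplitz : Series → Matrix
  Toeplitz g n k = shift^ k g n

  Toeplitz-cong : ∀ {a b} → a ≈S b → Toeplitz a ≈M Toeplitz b
  Toeplitz-cong a≈b n k = shift^-cong k a≈b n

  Riordan-t≈Toeplitz : ∀ g → Riordan g tS ≈M Toeplitz g
  Riordan-t≈Toeplitz g n k = trans (·-comm g (tS ^S k) n) (tS^-·≈shift^ k g n)

  QRiordan≈Toeplitz : ∀ {g f} → f ≈S (tS · g) → QRiordan g f ≈M Toeplitz g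
  QRiordan≈Toeplitz         f≈tg n zero    = refl
  QRiordan≈Toeplitz {g} {f} f≈tg n (suc j) = begin
    ((tS ^S j) · f) n      ≈⟨ tS^-·≈shift^ j f n ⟩
    shift^ j f n           ≈⟨ shift^-cong j (λ m → trans (f≈tg m) (tS-·≈shift g m)) n ⟩
    shift^ j (shift g) n   ≈⟨ shift^-shift j g n ⟩
    shift^ (suc j) g n     ∎

  Toeplitz-oneS≈Id : Toeplitz oneS ≈M Id
  Toeplitz-oneS≈Id zero    zero    = refl
  Toeplitz-oneS≈Id zero    (suc k) = refl
  Toeplitz-oneS≈Id (suc n) zero    = refl
  Toeplitz-oneS≈Id (suc n) (suc k) = Toeplitz-oneS≈Id n k

  ⊗-cong : ∀ {M M′ N N′} → M ≈M M′ → N ≈M N′ → (M ⊗ N) ≈M (M′ ⊗ N′)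
  ⊗-cong M≈M′ N≈N′ n k = sumTo-cong n (λ j _ → *-cong (M≈M′ n j) (N≈N′ j k))

  ⊗-congˡ : ∀ M {N N′} → N ≈M N′ → (M ⊗ N) ≈M (M ⊗ N′)
  ⊗-congˡ M = ⊗-cong (λ _ _ → refl)

  ⊗-congʳ : ∀ N {M M′} → M ≈M M′ → (M ⊗ N) ≈M (M′ ⊗ N)
  ⊗-congʳ N M≈M′ = ⊗-cong M≈M′ (λ _ _ → refl)

  Toeplitz-⊗ : ∀ g h → (Toeplitz g ⊗ Toeplitz h) ≈M Toeplitz (h · g)
  Toeplitz-⊗ g h n       zero    =
    sumTo-cong n (λ j j≤n → trans (*-congʳ (shift^-apply j g n j≤n)) (*-comm _ _))
  Toeplitz-⊗ g h zero    (suc k) = zeroʳ _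
  Toeplitz-⊗ g h (suc n) (suc k) =
    trans (sumTo-unconsˡ _ n) (trans (+-cong (zeroʳ _) (Toeplitz-⊗ g h n k)) (+-identityˡ _))

  QRiordan≈Riordan-columns : ∀ {g f g′ f′} → QRiordan g f ≈M Riordan g′ f′ →
    (g ≈S g′) × (f ≈S (g · f′)) × (shift f ≈S (g · (f′ · f′)))
  QRiordan≈Riordan-columns {g} {f} {g′} {f′} E = g≈g′ , f≈gf′ , tf≈gf′²
    where
    g≈g′ : g ≈S g′
    g≈g′ n = trans (E n 0) (·-identityʳ g′ n)
    f≈gf′ : f ≈S (g · f′)
    f≈gf′ n = begin
      f n                        ≈⟨ ·-identityˡ f n ⟨
      (oneS · f) n               ≈⟨ E n 1 ⟩
      (g′ · (oneS · f′)) n       ≈⟨ ·-cong (λ m → sym (g≈g′ m)) (·-identityˡ f′) n ⟩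
      (g · f′) n                 ∎
    tf≈gf′² : shift f ≈S (g · (f′ · f′))
    tf≈gf′² n = begin
      shift f n                  ≈⟨ tS-·≈shift f n ⟨
      (tS · f) n                 ≈⟨ ·-congʳ f (·-identityˡ tS) n ⟨
      ((oneS · tS) · f) n        ≈⟨ E n 2 ⟩
      (g′ · ((oneS · f′) · f′)) n ≈⟨ ·-cong (λ m → sym (g≈g′ m)) (·-congʳ f′ (·-identityˡ f′)) n ⟩
      (g · (f′ · f′)) n          ∎

  square≈shift⇒≈tS : ∀ {w f} → f 0 ≈ 0# → w * f 1 ≈ 1# → (f · f) ≈S shift f → f ≈S tS
  square≈shift⇒≈tS {w} {f} f₀≈0 wf₁≈1 f²≈tf n = begin
    f n               ≈⟨ f≈tu n ⟩
    shift u n         ≈⟨ shift-cong u≈1 n ⟩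
    shift oneS n      ≈⟨ tS≈shift-oneS n ⟨
    tS n              ∎
    where
    u : Series
    u n = f (suc n)
    f≈tu : f ≈S shift u
    f≈tu zero    = f₀≈0
    f≈tu (suc n) = refl
    t²u²≈t²u : shift (shift (u · u)) ≈S shift (shift (u · oneS))
    t²u²≈t²u n = begin
      shift (shift (u · u)) n        ≈⟨ shift-cong (·-shiftʳ u u) n ⟨
      shift (u · shift u) n          ≈⟨ ·-shiftˡ u (shift u) n ⟨
      (shift u · shift u) n          ≈⟨ ·-cong f≈tu f≈tu n ⟨
      (f · f) n                      ≈⟨ f²≈tf n ⟩
      shift f n                      ≈⟨ shift-cong f≈tu n ⟩
      shift (shift u) n              ≈⟨ shift-cong (shift-cong (·-identityʳ u)) n ⟨
      shift (shift (u · oneS)) n     ∎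
    u≈1 : u ≈S oneS
    u≈1 = ·-cancelˡ {w} {u} wf₁≈1 (shift-injective (shift-injective t²u²≈t²u))

  QRiordan≈Riordan-t : ∀ {g f} → f ≈S (tS · g) → QRiordan g f ≈M Riordan g tS
  QRiordan≈Riordan-t f≈tg n k = trans (QRiordan≈Toeplitz f≈tg n k) (sym (Riordan-t≈Toeplitz _ n k))

  QRiordan≈Riordan⇒≈tS· : ∀ {w g f g′ f′} → g 0 ≈ 1# → f′ 0 ≈ 0# → w * f′ 1 ≈ 1# →
    QRiordan g f ≈M Riordan g′ f′ → f ≈S (tS · g)
  QRiordan≈Riordan⇒≈tS· {g = g} {f} {f′ = f′} g₀≈1 f′₀≈0 wf′₁≈1 E n
    with _ , f≈gf′ , tf≈gf′² ← QRiordan≈Riordan-columns E = begin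
    f n          ≈⟨ f≈gf′ n ⟩
    (g · f′) n   ≈⟨ ·-congˡ g f′≈t n ⟩
    (g · tS) n   ≈⟨ ·-comm g tS n ⟩
    (tS · g) n   ∎
    where
    f′²≈tf′ : (f′ · f′) ≈S shift f′
    f′²≈tf′ = ·-cancelˡ {1#} (trans (*-identityˡ _) g₀≈1) (λ m → begin
      (g · (f′ · f′)) m   ≈⟨ tf≈gf′² m ⟨
      shift f m           ≈⟨ shift-cong f≈gf′ m ⟩
      shift (g · f′) m    ≈⟨ ·-shiftʳ g f′ m ⟨
      (g · shift f′) m    ∎)
    f′≈t : f′ ≈S tS
    f′≈t = square≈shift⇒≈tS f′₀≈0 wf′₁≈1 f′²≈tf′

  InAr⇒≈Toeplitz : ∀ {M g} → M ≈M QRiordan g (tS · g) → M ≈M Toeplitz g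
  InAr⇒≈Toeplitz M≈QR n k = trans (M≈QR n k) (QRiordan≈Toeplitz (λ _ → refl) n k)

  ≈Toeplitz⇒InAr : ∀ {M g} → g 0 ≈ 1# → M ≈M Toeplitz g → InAr M
  ≈Toeplitz⇒InAr {g = g} g₀≈1 M≈T =
    g , g₀≈1 , λ n k → trans (M≈T n k) (sym (QRiordan≈Toeplitz (λ _ → refl) n k))

  InAr⇒InRr : ¬ (1# ≈ 0#) → ∀ M → InAr M → InRr M
  InAr⇒InRr 1≉0 _ (g , g₀≈1 , M≈QR) = g , (tS · g) , g₀≈1 , (tS-·≈shift g 0 , tg₁≉0) , M≈QR
    where
    tg₁≉0 : ¬ ((tS · g) 1 ≈ 0#)
    tg₁≉0 = λ tg₁≈0 → 1≉0 (trans (sym g₀≈1) (trans (sym (tS-·≈shift g 1)) tg₁≈0))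

  Id∈Ar : InAr Id
  Id∈Ar = ≈Toeplitz⇒InAr refl (λ n k → sym (Toeplitz-oneS≈Id n k))

  InAr-⊗ : ∀ M N → InAr M → InAr N → InAr (M ⊗ N)
  InAr-⊗ _ _ (g , g₀≈1 , M≈QR) (h , h₀≈1 , N≈QR) =
    ≈Toeplitz⇒InAr (trans (*-cong h₀≈1 g₀≈1) (*-identityˡ 1#))
      (λ n k → trans (⊗-cong (InAr⇒≈Toeplitz M≈QR) (InAr⇒≈Toeplitz N≈QR) n k) (Toeplitz-⊗ g h n k))

  InAr-inverse : ∀ M → InAr M → Σ Matrix λ N → InAr N × ((M ⊗ N) ≈M Id) × ((N ⊗ M) ≈M Id)
  InAr-inverse M (g , g₀≈1 , M≈QR) =
    Toeplitz g⁻¹ , ≈Toeplitz⇒InAr refl (λ _ _ → refl) , M⊗N≈Id , N⊗M≈Id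
    where
    g⁻¹ : Series
    g⁻¹ = inverse g
    gg⁻¹≈1 : (g · g⁻¹) ≈S oneS
    gg⁻¹≈1 = ·-inverseʳ g g₀≈1
    M⊗N≈Id : (M ⊗ Toeplitz g⁻¹) ≈M Id
    M⊗N≈Id n k = begin
      (M ⊗ Toeplitz g⁻¹) n k             ≈⟨ ⊗-congʳ (Toeplitz g⁻¹) (InAr⇒≈Toeplitz M≈QR) n k ⟩
      (Toeplitz g ⊗ Toeplitz g⁻¹) n k    ≈⟨ Toeplitz-⊗ g g⁻¹ n k ⟩
      Toeplitz (g⁻¹ · g) n k             ≈⟨ Toeplitz-cong (λ m → trans (·-comm g⁻¹ g m) (gg⁻¹≈1 m)) n k ⟩
      Toeplitz oneS n k                  ≈⟨ Toeplitz-oneS≈Id n k ⟩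
      Id n k                             ∎
    N⊗M≈Id : (Toeplitz g⁻¹ ⊗ M) ≈M Id
    N⊗M≈Id n k = begin
      (Toeplitz g⁻¹ ⊗ M) n k             ≈⟨ ⊗-congˡ (Toeplitz g⁻¹) (InAr⇒≈Toeplitz M≈QR) n k ⟩
      (Toeplitz g⁻¹ ⊗ Toeplitz g) n k    ≈⟨ Toeplitz-⊗ g⁻¹ g n k ⟩
      Toeplitz (g · g⁻¹) n k             ≈⟨ Toeplitz-cong gg⁻¹≈1 n k ⟩
      Toeplitz oneS n k                  ≈⟨ Toeplitz-oneS≈Id n k ⟩
      Id n k                             ∎

theorem3p3 : ∀ {c ℓ} (R : CommutativeRing c ℓ) → IsField R →
    let open FPS R in
    (∀ (g f : Series) → g 0 ≈ 1# → Order1 f →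
    ((Σ Series λ g′ → Σ Series λ f′ → Order0 g′ × Order1 f′ × (QRiordan g f ≈M Riordan g′ f′))
    ⇔ (f ≈S (tS · g)))
    × ((f ≈S (tS · g)) → QRiordan g f ≈M Riordan g tS))
    × ((∀ M → InAr M → InRr M)
    × InAr Id
    × (∀ M N → InAr M → InAr N → InAr (M ⊗ N))
    × (∀ M → InAr M → Σ Matrix λ N → InAr N × ((M ⊗ N) ≈M Id) × ((N ⊗ M) ≈M Id)))
theorem3p3 R (1≉0 , inverses) =
  (λ _ _ g₀≈1 _ → mk⇔ (riordan⇒ g₀≈1) (⇒riordan g₀≈1) , QRiordan≈Riordan-t) ,
  InAr⇒InRr 1≉0 , Id∈Ar , InAr-⊗ , InAr-inverse
  where
  open CommutativeRing R
  open FPS R hiding (_≈_; _+_; _*_; 0#; 1#)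
  open SeriesProperties R

  riordan⇒ : ∀ {g f} → g 0 ≈ 1# →
    (Σ Series λ g′ → Σ Series λ f′ → Order0 g′ × Order1 f′ × (QRiordan g f ≈M Riordan g′ f′)) → f ≈S (tS · g)
  riordan⇒ g₀≈1 (_ , f′ , _ , (f′₀≈0 , f′₁≉0) , E) with inverses _ f′₁≉0
  ... | w , f′₁w≈1 = QRiordan≈Riordan⇒≈tS· g₀≈1 f′₀≈0 (trans (*-comm w _) f′₁w≈1) E

  ⇒riordan : ∀ {g f} → g 0 ≈ 1# → f ≈S (tS · g) →
    Σ Series λ g′ → Σ Series λ f′ → Order0 g′ × Order1 f′ × (QRiordan g f ≈M Riordan g′ f′)
  ⇒riordan {g} g₀≈1 f≈tg = g , tS , (λ g₀≈0 → 1≉0 (trans (sym g₀≈1) g₀≈0)) , (refl , 1≉0) , QRiordan≈Riordan-t f≈tg
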